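{- Let $H$ be the set of harmonic numbers and let $F$ be a finite set of $ndh$-numbers. Then the $abc$-conjecture is true on $H\cup F$: for every $\varepsilon>0$ there are only finitely many triples $(a,b,c)$ of coprime positive integers with $a,b,c\in H\cup F$, $a+b=c$ and $c>\operatorname{rad}(abc)^{1+\varepsilon}$.
   Context: A harmonic number is a positive integer of the form $2^a3^b$ with $a,b\ge 0$ integers (so $1$ is harmonic). A positive integer is an $ndh$-number if it cannot be written as a difference $h-k$ of two harmonic numbers $h,k$. For a positive integer $n$, $\operatorname{rad}(n)$ is the product of the distinct primes dividing $n$. Positive integers $a,b,c$ are coprime if they have no common prime factor.
   Formalization: The parameter ε ranges over the positive rationals. -}

module Defs where

open import Data.Nat using (ℕ; zero; suc; _+_; _*_; _^_; _<_; _≤_)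
open import Data.Nat.Divisibility using (_∣_; _∣?_)
open import Data.Nat.Primality using (Prime; prime?)
open import Data.List using (List; filter; upTo; _∷_; [])
open import Data.Nat.ListAction using (product)
open import Data.List.Membership.Propositional using (_∈_)
open import Data.Product using (Σ; ∃; _×_; _,_)
open import Data.Sum using (_⊎_)
open import Data.Empty using (⊥)
open import Relation.Nullary using (¬_)
open import Relation.Nullary.Decidable using (_×-dec_)
open import Relation.Binary.PropositionalEquality using (_≡_)

Harmonic : ℕ → Set
Harmonic n = Σ ℕ λ a → Σ ℕ λ b → n ≡ 2 ^ a * 3 ^ b

-- n is an ndh-number: a positive integer that is not h - k for harmonic h, k
-- (with n > 0, "n = h - k" means h = n + k)
NDH : ℕ → Set
NDH n = (0 < n) × ¬ (Σ ℕ λ h → Σ ℕ λ k → Harmonic h × Harmonic k × h ≡ n + k)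

-- rad n = product of the distinct primes p ≤ n dividing n (rad 0 = 1, unused)
rad : ℕ → ℕ
rad n = product (filter (λ p → prime? p ×-dec (p ∣? n)) (upTo (suc n)))

Coprime3 : ℕ → ℕ → ℕ → Set
Coprime3 a b c = ∀ p → Prime p → p ∣ a → p ∣ b → p ∣ c → ⊥

InHF : List ℕ → ℕ → Set
InHF F x = Harmonic x ⊎ x ∈ F

-- c > rad(abc)^(1+ε) with ε = p/q, i.e. c^q > rad(abc)^(q+p)
ABCExceptional : ℕ → ℕ → ℕ → ℕ → ℕ → Set
ABCExceptional p q a b c = rad (a * b * c) ^ (q + p) < c ^ q

BadTriple : List ℕ → ℕ → ℕ → ℕ → ℕ → ℕ → Set
BadTriple F p q a b c =
  (0 < a) × (0 < b) × (0 < c) × Coprime3 a b c ×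
  InHF F a × InHF F b × InHF F c × (a + b ≡ c) × ABCExceptional p q a b c

data Triple : Set where
  ⟨_,_,_⟩ : ℕ → ℕ → ℕ → Triple

module Submission where

-- Every coprime triple a + b = c with a, b, c in H ∪ F has c
-- bounded by a constant depending only on F.
-- Hence c ≤ 9 + 2 · max F, and the finite list of all triples with entries
-- up to this bound contains every exceptional triple.

open import Defs
open import Data.Nat using (ℕ; zero; suc; _+_; _*_; _^_; _%_; _≤_; _<_; s≤s)
open import Data.Nat.Properties
  using (≤ᵇ⇒≤; ≤-trans; +-comm; +-mono-≤; m≤m+n; m≤n+m; suc-injective; m+n≡0⇒n≡0; *-identityʳ; *-identityˡ)
open import Data.Nat.DivMod using (%-distribˡ-+; %-distribˡ-*)
open import Data.Nat.Divisibility using (_∣_; ∣-trans; m∣m*n; n∣m*n; ∣m∣n⇒∣m+n; ∣m+n∣m⇒∣n)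
open import Data.Nat.Primality using (Prime; prime?; prime[2])
open import Data.List using (List; upTo; cartesianProduct; cartesianProductWith)
open import Data.List.Extrema.Nat using (max; xs≤max)
open import Data.List.Relation.Unary.All using (All)
import Data.List.Relation.Unary.All as All
open import Data.List.Membership.Propositional using (_∈_)
open import Data.List.Membership.Propositional.Properties
  using (∈-upTo⁺; ∈-cartesianProductWith⁺; ∈-cartesianProduct⁺)
open import Data.Product using (Σ; _×_; _,_)
open import Data.Sum using (inj₁; inj₂)
open import Data.Empty using (⊥; ⊥-elim)
open import Relation.Nullary.Decidable using (toWitness)
open import Relation.Binary.PropositionalEquality using (_≡_; refl; sym; trans; cong; subst)

-- The residues of 2^x modulo 80 for x ≥ 4: the cycle 16 → 32 → 64 → 48.
data Pow2Mod80 : ℕ → Set where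
  r16 : Pow2Mod80 16
  r32 : Pow2Mod80 32
  r64 : Pow2Mod80 64
  r48 : Pow2Mod80 48

data Pow3Mod80 : ℕ → Set where
  r1  : Pow3Mod80 1
  r3  : Pow3Mod80 3
  r9  : Pow3Mod80 9
  r27 : Pow3Mod80 27

times2 : ∀ {u} → Pow2Mod80 u → Pow2Mod80 ((2 % 80 * u) % 80)
times2 r16 = r32
times2 r32 = r64
times2 r64 = r48
times2 r48 = r16

times3 : ∀ {u} → Pow3Mod80 u → Pow3Mod80 ((3 % 80 * u) % 80)
times3 r1  = r3
times3 r3  = r9
times3 r9  = r27
times3 r27 = r1

pow2-mod80 : ∀ x → Pow2Mod80 (2 ^ (4 + x) % 80)
pow2-mod80 zero    = r16
pow2-mod80 (suc x) =
  subst Pow2Mod80 (sym (%-distribˡ-* 2 (2 ^ (4 + x)) 80)) (times2 (pow2-mod80 x))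

pow3-mod80 : ∀ y → Pow3Mod80 (3 ^ y % 80)
pow3-mod80 zero    = r1
pow3-mod80 (suc y) =
  subst Pow3Mod80 (sym (%-distribˡ-* 3 (3 ^ y) 80)) (times3 (pow3-mod80 y))

pow2+1≢pow3 : ∀ {u} → Pow2Mod80 u → Pow3Mod80 ((u + 1 % 80) % 80) → ⊥
pow2+1≢pow3 r16 ()
pow2+1≢pow3 r32 ()
pow2+1≢pow3 r64 ()
pow2+1≢pow3 r48 ()

pow3+1≢pow2 : ∀ {v} → Pow3Mod80 v → Pow2Mod80 ((v + 1 % 80) % 80) → ⊥
pow3+1≢pow2 r1  ()
pow3+1≢pow2 r3  ()
pow3+1≢pow2 r9  ()
pow3+1≢pow2 r27 ()

succ-mod80 : ∀ {m n} → m + 1 ≡ n → (m % 80 + 1 % 80) % 80 ≡ n % 80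
succ-mod80 {m} eq = trans (sym (%-distribˡ-+ m 1 80)) (cong (_% 80) eq)

catalan₂₃ : ∀ x y → 2 ^ x + 1 ≡ 3 ^ y → 3 ^ y ≤ 9
catalan₂₃ 0 y eq = subst (_≤ 9) eq (≤ᵇ⇒≤ _ _ _)
catalan₂₃ 1 y eq = subst (_≤ 9) eq (≤ᵇ⇒≤ _ _ _)
catalan₂₃ 2 y eq = subst (_≤ 9) eq (≤ᵇ⇒≤ _ _ _)
catalan₂₃ 3 y eq = subst (_≤ 9) eq (≤ᵇ⇒≤ _ _ _)
catalan₂₃ (suc (suc (suc (suc x)))) y eq =
  ⊥-elim (pow2+1≢pow3 (pow2-mod80 x) (subst Pow3Mod80 (sym (succ-mod80 eq)) (pow3-mod80 y)))

catalan₃₂ : ∀ x y → 3 ^ y + 1 ≡ 2 ^ x → 2 ^ x ≤ 9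
catalan₃₂ 0 y eq = ≤ᵇ⇒≤ _ _ _
catalan₃₂ 1 y eq = ≤ᵇ⇒≤ _ _ _
catalan₃₂ 2 y eq = ≤ᵇ⇒≤ _ _ _
catalan₃₂ 3 y eq = ≤ᵇ⇒≤ _ _ _
catalan₃₂ (suc (suc (suc (suc x)))) y eq =
  ⊥-elim (pow3+1≢pow2 (pow3-mod80 y) (subst Pow2Mod80 (sym (succ-mod80 eq)) (pow2-mod80 x)))

harm : ℕ → ℕ → ℕ
harm x y = 2 ^ x * 3 ^ y

catalan₂₃-harm : ∀ x y → harm x 0 + 1 ≡ harm 0 y → harm 0 y ≤ 9
catalan₂₃-harm x y eq rewrite *-identityʳ (2 ^ x) | *-identityˡ (3 ^ y) = catalan₂₃ x y eq

catalan₃₂-harm : ∀ x y → harm 0 y + 1 ≡ harm x 0 → harm x 0 ≤ 9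
catalan₃₂-harm x y eq rewrite *-identityʳ (2 ^ x) | *-identityˡ (3 ^ y) = catalan₃₂ x y eq

2∣harm : ∀ x y → 2 ∣ harm (suc x) y
2∣harm x y = ∣-trans (m∣m*n (2 ^ x)) (m∣m*n (3 ^ y))

3∣harm : ∀ x y → 3 ∣ harm x (suc y)
3∣harm x y = ∣-trans (m∣m*n (3 ^ y)) (n∣m*n (2 ^ x))

prime[3] : Prime 3
prime[3] = toWitness {a? = prime? 3} _

AtMostOneDivisible : ℕ → ℕ → ℕ → ℕ → Set
AtMostOneDivisible p a b c =
  (p ∣ a → p ∣ b → ⊥) × (p ∣ a → p ∣ c → ⊥) × (p ∣ b → p ∣ c → ⊥)

-- In a coprime triple with a + b = c, a prime dividing two of the numbers
-- would divide the third, so every prime divides at most one of them.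
coprime-sum⇒at-most-one : ∀ {a b c p} → Coprime3 a b c → a + b ≡ c → Prime p →
  AtMostOneDivisible p a b c
coprime-sum⇒at-most-one {a} {b} {c} {p} cop eq pr =
  (λ p∣a p∣b → cop p pr p∣a p∣b (subst (p ∣_) eq (∣m∣n⇒∣m+n p∣a p∣b))) ,
  (λ p∣a p∣c → cop p pr p∣a (∣m+n∣m⇒∣n (subst (p ∣_) (sym eq) p∣c) p∣a) p∣c) ,
  (λ p∣b p∣c → cop p pr (∣m+n∣m⇒∣n (subst (p ∣_) (sym b+a≡c) p∣c) p∣b) p∣b p∣c)
  where
  b+a≡c : b + a ≡ c
  b+a≡c = trans (+-comm b a) eq

positive-sum≢1 : ∀ {a b} → 0 < a → 0 < b → a + b ≡ 1 → ⊥
positive-sum≢1 {suc a} {suc b} _ _ eq with m+n≡0⇒n≡0 a (suc-injective eq)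
... | ()

-- Harmonic sums a + b = c in which 2 and 3 each divide at most one term
-- satisfy c ≤ 9.  The first six clauses rule out a shared factor 2 or 3;
-- what remains is 1 + 1 = 2, the impossible c = 1, and the two
-- Catalan-type equations (with the summands in either order).
harmonic-sum-bound : ∀ x₁ y₁ x₂ y₂ x₃ y₃ →
  let a = harm x₁ y₁ ; b = harm x₂ y₂ ; c = harm x₃ y₃ in
  AtMostOneDivisible 2 a b c → AtMostOneDivisible 3 a b c →
  0 < a → 0 < b → a + b ≡ c → c ≤ 9
harmonic-sum-bound (suc x₁) y₁ (suc x₂) y₂ x₃ y₃ (ab , _ , _) _ _ _ _ = ⊥-elim (ab (2∣harm x₁ y₁) (2∣harm x₂ y₂))
harmonic-sum-bound (suc x₁) y₁ x₂ y₂ (suc x₃) y₃ (_ , ac , _) _ _ _ _ = ⊥-elim (ac (2∣harm x₁ y₁) (2∣harm x₃ y₃))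
harmonic-sum-bound x₁ y₁ (suc x₂) y₂ (suc x₃) y₃ (_ , _ , bc) _ _ _ _ = ⊥-elim (bc (2∣harm x₂ y₂) (2∣harm x₃ y₃))
harmonic-sum-bound x₁ (suc y₁) x₂ (suc y₂) x₃ y₃ _ (ab , _ , _) _ _ _ = ⊥-elim (ab (3∣harm x₁ y₁) (3∣harm x₂ y₂))
harmonic-sum-bound x₁ (suc y₁) x₂ y₂ x₃ (suc y₃) _ (_ , ac , _) _ _ _ = ⊥-elim (ac (3∣harm x₁ y₁) (3∣harm x₃ y₃))
harmonic-sum-bound x₁ y₁ x₂ (suc y₂) x₃ (suc y₃) _ (_ , _ , bc) _ _ _ = ⊥-elim (bc (3∣harm x₂ y₂) (3∣harm x₃ y₃))
harmonic-sum-bound 0 0 0 0 x₃ y₃ _ _ _ _ eq = subst (_≤ 9) eq (≤ᵇ⇒≤ _ _ _)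
harmonic-sum-bound x₁ y₁ x₂ y₂ 0 0 _ _ a>0 b>0 eq = ⊥-elim (positive-sum≢1 a>0 b>0 eq)
harmonic-sum-bound (suc x) 0 0 0 0 (suc y) _ _ _ _ eq = catalan₂₃-harm (suc x) (suc y) eq
harmonic-sum-bound 0 0 (suc x) 0 0 (suc y) _ _ _ _ eq =
  catalan₂₃-harm (suc x) (suc y) (trans (+-comm (harm (suc x) 0) 1) eq)
harmonic-sum-bound 0 (suc y) 0 0 (suc x) 0 _ _ _ _ eq = catalan₃₂-harm (suc x) (suc y) eq
harmonic-sum-bound 0 0 0 (suc y) (suc x) 0 _ _ _ _ eq =
  catalan₃₂-harm (suc x) (suc y) (trans (+-comm (harm 0 (suc y)) 1) eq)

harmonic-triple-bound : ∀ {a b c} → Harmonic a → Harmonic b → Harmonic c →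
  Coprime3 a b c → 0 < a → 0 < b → a + b ≡ c → c ≤ 9
harmonic-triple-bound (x₁ , y₁ , refl) (x₂ , y₂ , refl) (x₃ , y₃ , refl) cop a>0 b>0 eq =
  harmonic-sum-bound x₁ y₁ x₂ y₂ x₃ y₃
    (coprime-sum⇒at-most-one cop eq prime[2]) (coprime-sum⇒at-most-one cop eq prime[3])
    a>0 b>0 eq

ndh-not-gap : ∀ {n k c} → NDH n → Harmonic k → Harmonic c → n + k ≡ c → ⊥
ndh-not-gap (_ , not-difference) hk hc eq = not-difference (_ , _ , hc , hk , sym eq)

bound : List ℕ → ℕ
bound F = 9 + (max 0 F + max 0 F)

∈⇒≤max : ∀ {x F} → x ∈ F → x ≤ max 0 F
∈⇒≤max {F = F} = All.lookup (xs≤max 0 F)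

coprime-sum-bound : ∀ {F a b c} → All NDH F → 0 < a → 0 < b → Coprime3 a b c →
  InHF F a → InHF F b → InHF F c → a + b ≡ c → c ≤ bound F
coprime-sum-bound {F} _ _ _ _ _ _ (inj₂ c∈F) _ =
  ≤-trans (∈⇒≤max c∈F) (≤-trans (m≤m+n (max 0 F) (max 0 F)) (m≤n+m _ 9))
coprime-sum-bound _ _ _ _ (inj₂ a∈F) (inj₂ b∈F) (inj₁ _) eq =
  subst (_≤ _) eq (≤-trans (+-mono-≤ (∈⇒≤max a∈F) (∈⇒≤max b∈F)) (m≤n+m _ 9))
coprime-sum-bound ndh _ _ _ (inj₂ a∈F) (inj₁ hb) (inj₁ hc) eq =
  ⊥-elim (ndh-not-gap (All.lookup ndh a∈F) hb hc eq)
coprime-sum-bound {a = a} {b} ndh _ _ _ (inj₁ ha) (inj₂ b∈F) (inj₁ hc) eq =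
  ⊥-elim (ndh-not-gap (All.lookup ndh b∈F) ha hc (trans (+-comm b a) eq))
coprime-sum-bound _ a>0 b>0 cop (inj₁ ha) (inj₁ hb) (inj₁ hc) eq =
  ≤-trans (harmonic-triple-bound ha hb hc cop a>0 b>0 eq) (m≤m+n 9 _)

mkTriple : ℕ → ℕ × ℕ → Triple
mkTriple a (b , c) = ⟨ a , b , c ⟩

triplesUpTo : ℕ → List Triple
triplesUpTo N = cartesianProductWith mkTriple R (cartesianProduct R R)
  where
  R : List ℕ
  R = upTo (suc N)

∈-triplesUpTo : ∀ {N a b c} → a ≤ N → b ≤ N → c ≤ N → ⟨ a , b , c ⟩ ∈ triplesUpTo N
∈-triplesUpTo a≤N b≤N c≤N =
  ∈-cartesianProductWith⁺ mkTriple (∈-upTo⁺ (s≤s a≤N))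
    (∈-cartesianProduct⁺ (∈-upTo⁺ (s≤s b≤N)) (∈-upTo⁺ (s≤s c≤N)))

-- Every bad triple has c ≤ bound F, hence a, b ≤ c ≤ bound F, so it occurs
-- among the triples with entries at most bound F.
proposition2p3 : (F : List ℕ) → All NDH F →
    (p q : ℕ) → 0 < p → 0 < q →
    Σ (List Triple) λ L →
      (a b c : ℕ) → BadTriple F p q a b c → ⟨ a , b , c ⟩ ∈ L
proposition2p3 F ndh p q _ _ = triplesUpTo (bound F) , listed
  where
  listed : (a b c : ℕ) → BadTriple F p q a b c → ⟨ a , b , c ⟩ ∈ triplesUpTo (bound F)
  listed a b c (a>0 , b>0 , _ , cop , ha , hb , hc , eq , _) =
    ∈-triplesUpTo (≤-trans (subst (a ≤_) eq (m≤m+n a b)) c≤bound)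
                  (≤-trans (subst (b ≤_) eq (m≤n+m b a)) c≤bound)
                  c≤bound
    where
    c≤bound : c ≤ bound F
    c≤bound = coprime-sum-bound ndh a>0 b>0 cop ha hb hc eq
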